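{- Let $L$ be a pretransitive normal modal logic, let $F=(X,R)$ be its canonical frame, and let $\Psi$ be a set of formulas. If $V=\{a\in X:\Psi\subseteq a\}$ is non-empty, then $V$ has a maximal element, i.e. some $a\in V$ such that for all $b\in V$, $aR^*b$ implies $bR^*a$.
   Context: A normal modal logic is $m$-transitive if it contains $\lozenge^{m+1}p\to\bigvee_{i\le m}\lozenge^ip$, and pretransitive if it is $m$-transitive for some $m\ge0$. The canonical frame of $L$ has as points the maximal $L$-consistent sets of formulas, with $aRb$ iff $\{\varphi:\Box\varphi\in a\}\subseteq b$. $R^*$ is the reflexive transitive closure of $R$. -}

module Defs where

open import Data.Nat using (ℕ; zero; suc)
open import Data.Bool using (Bool; true; false; not; _∨_)
open import Data.List using (List; []; _∷_)
open import Data.List.Relation.Unary.All using (All)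
open import Data.Product using (Σ; ∃; _×_; _,_)
open import Relation.Binary.PropositionalEquality using (_≡_)
open import Relation.Nullary using (¬_)
open import Relation.Binary.Construct.Closure.ReflexiveTransitive using (Star)

data Fm : Set where
  var  : ℕ → Fm
  ⊥'   : Fm
  _⇒_  : Fm → Fm → Fm
  □_   : Fm → Fm

infixr 5 _⇒_
infix 7 □_ ◇_ ~_

~_ : Fm → Fm
~ φ = φ ⇒ ⊥'

⊤' : Fm
⊤' = ⊥' ⇒ ⊥'

_∨'_ : Fm → Fm → Fm
φ ∨' ψ = (~ φ) ⇒ ψ

_∧'_ : Fm → Fm → Fm
φ ∧' ψ = ~ (φ ⇒ ~ ψ)

◇_ : Fm → Fm
◇ φ = ~ (□ (~ φ))

◇^ : ℕ → Fm → Fm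
◇^ zero    φ = φ
◇^ (suc n) φ = ◇ (◇^ n φ)

bigDisj◇ : ℕ → Fm → Fm
bigDisj◇ zero    φ = φ
bigDisj◇ (suc m) φ = bigDisj◇ m φ ∨' ◇^ (suc m) φ

⋀ : List Fm → Fm
⋀ []       = ⊤'
⋀ (φ ∷ φs) = φ ∧' ⋀ φs

eval : (Fm → Bool) → Fm → Bool
eval v (var n) = v (var n)
eval v ⊥'      = false
eval v (φ ⇒ ψ) = not (eval v φ) ∨ eval v ψ
eval v (□ φ)   = v (□ φ)

Tautology : Fm → Set
Tautology φ = ∀ (v : Fm → Bool) → eval v φ ≡ true

subst : (ℕ → Fm) → Fm → Fm
subst σ (var n) = σ n
subst σ ⊥'      = ⊥'
subst σ (φ ⇒ ψ) = subst σ φ ⇒ subst σ ψ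
subst σ (□ φ)   = □ subst σ φ

FmSet : Set₁
FmSet = Fm → Set

_⊆_ : FmSet → FmSet → Set
Γ ⊆ Δ = ∀ φ → Γ φ → Δ φ

p₀ p₁ : Fm
p₀ = var 0
p₁ = var 1

record NormalLogic (L : FmSet) : Set where
  field
    taut  : ∀ φ → Tautology φ → L φ
    axK   : L (□ (p₀ ⇒ p₁) ⇒ (□ p₀ ⇒ □ p₁))
    mp    : ∀ φ ψ → L φ → L (φ ⇒ ψ) → L ψ
    nec   : ∀ φ → L φ → L (□ φ)
    usubst : ∀ σ φ → L φ → L (subst σ φ)

Transitive[_] : ℕ → FmSet → Set
Transitive[ m ] L = L (◇^ (suc m) p₀ ⇒ bigDisj◇ m p₀)

Pretransitive : FmSet → Set
Pretransitive L = ∃ λ m → Transitive[ m ] L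

Consistent : FmSet → FmSet → Set
Consistent L Γ = ¬ (Σ (List Fm) λ φs → All Γ φs × L (~ ⋀ φs))

MaxConsistent : FmSet → FmSet → Set₁
MaxConsistent L Γ = Consistent L Γ × (∀ Δ → Consistent L Δ → Γ ⊆ Δ → Δ ⊆ Γ)

record Point (L : FmSet) : Set₁ where
  constructor point
  field
    set    : FmSet
    maxcon : MaxConsistent L set
open Point public

CanR : (L : FmSet) → Point L → Point L → Set
CanR L a b = ∀ φ → set a (□ φ) → set b φ

CanR* : (L : FmSet) → Point L → Point L → Set₁
CanR* L = Star (CanR L)

{-# OPTIONS --safe #-}
module Submission where

-- Extend Ψ by a Lindenbaum construction that adds a whole orbit {□ᵏφ : k ∈ ℕ} whenever
-- this keeps the set consistent, and let a be a maximal consistent extension of the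
-- result Γ. If Ψ ⊆ b and aR*b, then Γ ⊆ b, since orbits contained in a are inherited
-- along R*; so, Γ being saturated, every φ whose whole orbit lies in b lies in a.
-- One power suffices: for some i, □ⁱφ ∈ b implies φ ∈ a for every φ. Otherwise the
-- disjunction ψ of counterexamples for i ≤ m has □ⁱψ ∈ b for all i ≤ m, hence by
-- m-transitivity for all i, while ψ ∉ a. For i > 0 the existence lemma turns this into a path
-- bRⁱa; for i = 0 we get b ⊆ a, and then the path from a to b can be reversed.

open import Defs
open import Level using (0ℓ)
open import Axiom.ExcludedMiddle using (ExcludedMiddle)
open import Axiom.DoubleNegationElimination using (em⇒dne)
open import Function using (_∘_; id)
open import Function.Bundles using (Equivalence)
open import Data.Bool using (Bool; true; false; T; not; _∧_; _∨_)
open import Data.Bool.Properties using (T-∧; T-≡)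
open import Data.Nat using (ℕ; zero; suc; _<_; _≤_; _≤′_; ≤′-refl; ≤′-step; _<ᵇ_; _⊔_; z≤n; s≤s)
open import Data.Nat.Properties using (<ᵇ⇒<; ≤⇒≤′; m≤m⊔n; m≤n⊔m; ≤-refl; m≤n⇒m≤1+n; m≤n⇒m<n∨m≡n)
open import Data.Product using (Σ; ∃; _×_; _,_; proj₁; proj₂)
open import Data.Sum using (_⊎_; inj₁; inj₂; [_,_]′; map₂)
open import Data.Empty using (⊥; ⊥-elim)
open import Data.Vec using (Vec; []; _∷_)
open import Data.List using (List; []; _∷_; _++_; map; foldl; cartesianProductWith)
open import Data.List.Relation.Unary.All using (All; []; _∷_)
import Data.List.Relation.Unary.All as All
open import Data.List.Relation.Unary.All.Properties using (++⁺; map⁺)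
open import Data.List.Relation.Unary.Any using (here; there)
open import Data.List.Membership.Propositional using (_∈_)
open import Data.List.Membership.Propositional.Properties
  using (∈-++⁺ˡ; ∈-++⁺ʳ; ∈-map⁺; ∈-cartesianProductWith⁺)
open import Relation.Nullary using (¬_; yes; no)
open import Relation.Unary using (_∪_; ｛_｝; ⋃)
open import Relation.Binary.PropositionalEquality using (_≡_; refl; sym; cong; cong₂)
import Relation.Binary.PropositionalEquality as ≡
open import Relation.Binary.Construct.Closure.ReflexiveTransitive using (ε; _◅_)

allRows : (k : ℕ) → (Vec Bool k → Bool) → Bool
allRows zero    f = f []
allRows (suc k) f = allRows k (f ∘ (true ∷_)) ∧ allRows k (f ∘ (false ∷_))

allRows-sound : ∀ k f → T (allRows k f) → ∀ bs → T (f bs)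
allRows-sound zero    f h []           = h
allRows-sound (suc k) f h (true ∷ bs)  = allRows-sound k _ (proj₁ (Equivalence.to T-∧ h)) bs
allRows-sound (suc k) f h (false ∷ bs) = allRows-sound k _ (proj₂ (Equivalence.to T-∧ h)) bs

nth : ∀ {k} → Vec Bool k → ℕ → Bool
nth []       _       = false
nth (b ∷ _)  zero    = b
nth (_ ∷ bs) (suc n) = nth bs n

row : (k : ℕ) → (ℕ → Bool) → Vec Bool k
row zero    f = []
row (suc k) f = f 0 ∷ row k (f ∘ suc)

nth-row : ∀ k f n → n < k → nth (row k f) n ≡ f n
nth-row (suc k) f zero    _         = refl
nth-row (suc k) f (suc n) (s≤s n<k) = nth-row k (f ∘ suc) n n<k

Propositional : ℕ → Fm → Bool
Propositional k (var n) = n <ᵇ k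
Propositional k ⊥'      = true
Propositional k (φ ⇒ ψ) = Propositional k φ ∧ Propositional k ψ
Propositional k (□ φ)   = false

atoms : ∀ {k} → Vec Bool k → Fm → Bool
atoms bs (var n) = nth bs n
atoms bs _       = false

eval-atoms : ∀ k v t → T (Propositional k t) → eval v t ≡ eval (atoms (row k (v ∘ var))) t
eval-atoms k v (var n) h = sym (nth-row k (v ∘ var) n (<ᵇ⇒< n k h))
eval-atoms k v ⊥'      h = refl
eval-atoms k v (φ ⇒ ψ) h = cong₂ (λ x y → not x ∨ y)
  (eval-atoms k v φ (proj₁ (Equivalence.to T-∧ h)))
  (eval-atoms k v ψ (proj₂ (Equivalence.to T-∧ h)))

IsTautology : ℕ → Fm → Bool
IsTautology k t = Propositional k t ∧ allRows k (λ bs → eval (atoms bs) t)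

truthTable-sound : ∀ k t → T (IsTautology k t) → Tautology t
truthTable-sound k t h v = Equivalence.to T-≡
  (≡.subst T (sym (eval-atoms k v t (proj₁ h′))) (allRows-sound k _ (proj₂ h′) (row k (v ∘ var))))
  where
  h′ : T (Propositional k t) × T (allRows k (λ bs → eval (atoms bs) t))
  h′ = Equivalence.to T-∧ h

eval-subst : ∀ v σ t → eval v (subst σ t) ≡ eval (eval v ∘ subst σ) t
eval-subst v σ (var n) = refl
eval-subst v σ ⊥'      = refl
eval-subst v σ (φ ⇒ ψ) = cong₂ (λ x y → not x ∨ y) (eval-subst v σ φ) (eval-subst v σ ψ)
eval-subst v σ (□ φ)   = refl

Tautology-subst : ∀ σ {t} → Tautology t → Tautology (subst σ t)
Tautology-subst σ {t} t-taut v = ≡.trans (eval-subst v σ t) (t-taut (eval v ∘ subst σ))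

instantiate : List Fm → ℕ → Fm
instantiate []       _       = ⊥'
instantiate (φ ∷ _)  zero    = φ
instantiate (_ ∷ φs) (suc n) = instantiate φs n

p₂ p₃ p₄ : Fm
p₂ = var 2
p₃ = var 3
p₄ = var 4

◇^-subst : ∀ σ n → subst σ (◇^ n p₀) ≡ ◇^ n (σ 0)
◇^-subst σ zero    = refl
◇^-subst σ (suc n) = cong ◇_ (◇^-subst σ n)

bigDisj◇-subst : ∀ σ m → subst σ (bigDisj◇ m p₀) ≡ bigDisj◇ m (σ 0)
bigDisj◇-subst σ zero    = refl
bigDisj◇-subst σ (suc m) = cong₂ _∨'_ (bigDisj◇-subst σ m) (◇^-subst σ (suc m))

box^ : ℕ → Fm → Fm
box^ zero    φ = φ
box^ (suc n) φ = □ box^ n φ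

box^-□ : ∀ n φ → box^ n (□ φ) ≡ box^ (suc n) φ
box^-□ zero    φ = refl
box^-□ (suc n) φ = cong □_ (box^-□ n φ)

boxes : Fm → FmSet
boxes φ χ = ∃ λ k → χ ≡ box^ k φ

Transfer : ∀ {L} → ℕ → Point L → Point L → Set
Transfer n b a = ∀ φ → set b (box^ n φ) → set a φ

Transfer* : ∀ {L} → Point L → Point L → Set
Transfer* b a = ∀ φ → boxes φ ⊆ set b → set a φ

Increasing : (ℕ → FmSet) → Set
Increasing Γ = ∀ n → Γ n ⊆ Γ (suc n)

increasing-≤′ : ∀ {Γ} → Increasing Γ → ∀ {m n} → m ≤′ n → Γ m ⊆ Γ n
increasing-≤′ inc ≤′-refl            φ = id
increasing-≤′ inc (≤′-step {n} m≤′n) φ = inc n φ ∘ increasing-≤′ inc m≤′n φ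

increasing-≤ : ∀ {Γ} → Increasing Γ → ∀ {m n} → m ≤ n → Γ m ⊆ Γ n
increasing-≤ inc = increasing-≤′ inc ∘ ≤⇒≤′

All-⋃ : ∀ {Γ} → Increasing Γ → ∀ {φs} → All (⋃ ℕ Γ) φs → ∃ λ n → All (Γ n) φs
All-⋃ inc []             = 0 , []
All-⋃ inc ((m , h) ∷ hs) with All-⋃ inc hs
... | n , hs′ = m ⊔ n , increasing-≤ inc (m≤m⊔n m n) _ h
                      ∷ All.map (increasing-≤ inc (m≤n⊔m m n) _) hs′

enum : ℕ → List Fm
enum zero    = ⊥' ∷ []
enum (suc n) = enum n ++ var n ∷ map □_ (enum n) ++ cartesianProductWith _⇒_ (enum n) (enum n)

enum-increasing : Increasing (λ n φ → φ ∈ enum n)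
enum-increasing n φ = ∈-++⁺ˡ

enum-complete : ∀ φ → ∃ λ n → φ ∈ enum n
enum-complete (var n) = suc n , ∈-++⁺ʳ (enum n) (here refl)
enum-complete ⊥'      = 0 , here refl
enum-complete (□ φ) with enum-complete φ
... | n , φ∈ = suc n , ∈-++⁺ʳ (enum n) (there (∈-++⁺ˡ (∈-map⁺ □_ φ∈)))
enum-complete (φ ⇒ ψ) with enum-complete φ | enum-complete ψ
... | m , φ∈ | n , ψ∈ = suc (m ⊔ n) , ∈-++⁺ʳ (enum (m ⊔ n)) (there (∈-++⁺ʳ (map □_ (enum (m ⊔ n)))
  (∈-cartesianProductWith⁺ _⇒_ (increasing-≤ enum-increasing (m≤m⊔n m n) φ φ∈)
                               (increasing-≤ enum-increasing (m≤n⊔m m n) ψ ψ∈))))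

Consistent-⊆ : ∀ {L Γ Δ} → Γ ⊆ Δ → Consistent L Δ → Consistent L Γ
Consistent-⊆ Γ⊆Δ Δ-con (φs , hs , d) = Δ-con (φs , All.map (Γ⊆Δ _) hs , d)

⋃-consistent : ∀ {L Γ} → Increasing Γ → (∀ n → Consistent L (Γ n)) → Consistent L (⋃ ℕ Γ)
⋃-consistent inc con (φs , hs , d) with All-⋃ inc hs
... | n , hs′ = con n (φs , hs′ , d)

module Saturation (L : FmSet) (F : Fm → FmSet) (Γ₀ : FmSet) where

  extend : FmSet → Fm → FmSet
  extend Θ φ = Θ ∪ (λ χ → F φ χ × Consistent L (Θ ∪ F φ))

  stage : ℕ → FmSet
  stage zero    = Γ₀
  stage (suc n) = foldl extend (stage n) (enum n)

  limit : FmSet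
  limit = ⋃ ℕ stage

  foldl-extend-⊇ : ∀ Θ φs → Θ ⊆ foldl extend Θ φs
  foldl-extend-⊇ Θ []       χ = id
  foldl-extend-⊇ Θ (φ ∷ φs) χ = foldl-extend-⊇ (extend Θ φ) φs χ ∘ inj₁

  stage-increasing : Increasing stage
  stage-increasing n = foldl-extend-⊇ (stage n) (enum n)

  Γ₀⊆limit : Γ₀ ⊆ limit
  Γ₀⊆limit χ h = 0 , h

  -- Constructive: whether or not Θ ∪ F φ is consistent, d leads to ⊥.
  extend-consistent : ∀ {Θ} φ → Consistent L Θ → Consistent L (extend Θ φ)
  extend-consistent {Θ} φ Θ-con d = rejected (λ accepted → Consistent-⊆ {L} ⊆Θ∪Fφ accepted d)
    where
    ⊆Θ∪Fφ : extend Θ φ ⊆ (Θ ∪ F φ)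
    ⊆Θ∪Fφ χ = map₂ proj₁
    rejected : ¬ Consistent L (Θ ∪ F φ) → ⊥
    rejected ¬con = Consistent-⊆ {L} ⊆Θ Θ-con d
      where
      ⊆Θ : extend Θ φ ⊆ Θ
      ⊆Θ χ (inj₁ h)         = h
      ⊆Θ χ (inj₂ (_ , con)) = ⊥-elim (¬con con)

  foldl-extend-consistent : ∀ Θ φs → Consistent L Θ → Consistent L (foldl extend Θ φs)
  foldl-extend-consistent Θ []       = id
  foldl-extend-consistent Θ (φ ∷ φs) = foldl-extend-consistent (extend Θ φ) φs ∘ extend-consistent φ

  stage-consistent : Consistent L Γ₀ → ∀ n → Consistent L (stage n)
  stage-consistent con zero    = con
  stage-consistent con (suc n) = foldl-extend-consistent (stage n) (enum n) (stage-consistent con n)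

  limit-consistent : Consistent L Γ₀ → Consistent L limit
  limit-consistent con = ⋃-consistent {L} stage-increasing (stage-consistent con)

  foldl-extend-saturated : ∀ {Δ φ} → Consistent L Δ → F φ ⊆ Δ → ∀ Θ φs → φ ∈ φs →
                           foldl extend Θ φs ⊆ Δ → F φ ⊆ foldl extend Θ φs
  foldl-extend-saturated {Δ} {φ} Δ-con Fφ⊆Δ Θ (φ ∷ φs) (here refl) ⊆Δ χ h =
    foldl-extend-⊇ (extend Θ φ) φs χ (inj₂ (h , Consistent-⊆ {L} Θ∪Fφ⊆Δ Δ-con))
    where
    Θ∪Fφ⊆Δ : (Θ ∪ F φ) ⊆ Δ
    Θ∪Fφ⊆Δ ψ (inj₁ h′) = ⊆Δ ψ (foldl-extend-⊇ (extend Θ φ) φs ψ (inj₁ h′))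
    Θ∪Fφ⊆Δ ψ (inj₂ h′) = Fφ⊆Δ ψ h′
  foldl-extend-saturated Δ-con Fφ⊆Δ Θ (ψ ∷ φs) (there φ∈) =
    foldl-extend-saturated Δ-con Fφ⊆Δ (extend Θ ψ) φs φ∈

  limit-saturated : ∀ {Δ} → Consistent L Δ → limit ⊆ Δ → ∀ φ → F φ ⊆ Δ → F φ ⊆ limit
  limit-saturated Δ-con limit⊆Δ φ Fφ⊆Δ χ h with enum-complete φ
  ... | n , φ∈ = suc n , foldl-extend-saturated Δ-con Fφ⊆Δ (stage n) (enum n) φ∈
                           (λ ψ → limit⊆Δ ψ ∘ (suc n ,_)) χ h

  Generated : FmSet → Set
  Generated Θ = ∀ χ → Θ χ → Γ₀ χ ⊎ ∃ λ φ → F φ χ × F φ ⊆ Θ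

  extend-generated : ∀ {Θ} φ → Generated Θ → Generated (extend Θ φ)
  extend-generated φ gen χ (inj₁ h) with gen χ h
  ... | inj₁ h₀                = inj₁ h₀
  ... | inj₂ (ψ , Fψχ , Fψ⊆Θ) = inj₂ (ψ , Fψχ , λ ξ → inj₁ ∘ Fψ⊆Θ ξ)
  extend-generated φ gen χ (inj₂ (Fφχ , con)) = inj₂ (φ , Fφχ , λ ξ Fφξ → inj₂ (Fφξ , con))

  foldl-extend-generated : ∀ Θ φs → Generated Θ → Generated (foldl extend Θ φs)
  foldl-extend-generated Θ []       = id
  foldl-extend-generated Θ (φ ∷ φs) = foldl-extend-generated (extend Θ φ) φs ∘ extend-generated φ

  stage-generated : ∀ n → Generated (stage n)
  stage-generated zero    χ = inj₁
  stage-generated (suc n)   = foldl-extend-generated (stage n) (enum n) (stage-generated n)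

  limit-generated : Generated limit
  limit-generated χ (n , h) with stage-generated n χ h
  ... | inj₁ h₀                   = inj₁ h₀
  ... | inj₂ (φ , Fφχ , Fφ⊆stage) = inj₂ (φ , Fφχ , λ ξ → (n ,_) ∘ Fφ⊆stage ξ)

lindenbaum : ∀ {L Γ} → Consistent L Γ → ∃ λ (a : Point L) → Γ ⊆ set a
lindenbaum {L} {Γ} con = point limit (limit-consistent con , maximal) , Γ₀⊆limit
  where
  open Saturation L ｛_｝ Γ
  maximal : ∀ Δ → Consistent L Δ → limit ⊆ Δ → Δ ⊆ limit
  maximal Δ Δ-con limit⊆Δ φ φ∈Δ = limit-saturated Δ-con limit⊆Δ φ (λ { _ refl → φ∈Δ }) φ refl

boxes-R* : ∀ {L} {a b : Point L} → CanR* L a b → ∀ φ → boxes φ ⊆ set a → boxes φ ⊆ set b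
boxes-R* ε           φ = id
boxes-R* (aRx ◅ x↝b) φ h = boxes-R* x↝b φ (λ { _ (k , refl) → aRx _ (h _ (suc k , refl)) })

R⁺-retarget : ∀ {L} {x y b a : Point L} → CanR L x y → CanR* L y b → set b ⊆ set a → CanR* L x a
R⁺-retarget         xRy ε                     b⊆a = (λ φ → b⊆a φ ∘ xRy φ) ◅ ε
R⁺-retarget {y = y} xRy (_◅_ {j = z} yRz z↝b) b⊆a = _◅_ {j = y} xRy (R⁺-retarget {y = z} yRz z↝b b⊆a)

R*-reverse-⊆ : ∀ {L} {a b : Point L} → set b ⊆ set a → CanR* L a b → CanR* L b a
R*-reverse-⊆ b⊆a ε           = ε
R*-reverse-⊆ b⊆a (aRx ◅ x↝b) = R⁺-retarget (λ φ → aRx φ ∘ b⊆a (□ φ)) x↝b b⊆a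

module Derivability {L : FmSet} (NL : NormalLogic L) where
  open NormalLogic NL

  infixl 5 _·_
  _·_ : ∀ {φ ψ} → L (φ ⇒ ψ) → L φ → L ψ
  f · x = mp _ _ x f

  -- The implicit truth-table check is solved by normalisation for each concrete schema t.
  taut₅ : (t : Fm) {_ : T (IsTautology 5 t)} (σ : List Fm) → L (subst (instantiate σ) t)
  taut₅ t {valid} σ = taut _ (Tautology-subst (instantiate σ) {t} (truthTable-sound 5 t valid))

  ⇒-trans : ∀ {φ ψ χ} → L (φ ⇒ ψ) → L (ψ ⇒ χ) → L (φ ⇒ χ)
  ⇒-trans {φ} {ψ} {χ} f g = taut₅ ((p₀ ⇒ p₁) ⇒ (p₁ ⇒ p₂) ⇒ p₀ ⇒ p₂) (φ ∷ ψ ∷ χ ∷ []) · f · g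

  ⇒-contra : ∀ {φ ψ} → L (φ ⇒ ψ) → L (~ ψ ⇒ ~ φ)
  ⇒-contra {φ} {ψ} f = taut₅ ((p₀ ⇒ p₁) ⇒ ~ p₁ ⇒ ~ p₀) (φ ∷ ψ ∷ []) · f

  ∧'-curry-swap : ∀ {φ ψ χ} → L (φ ∧' ψ ⇒ χ) → L (ψ ⇒ φ ⇒ χ)
  ∧'-curry-swap {φ} {ψ} {χ} f = taut₅ ((p₀ ∧' p₁ ⇒ p₂) ⇒ p₁ ⇒ p₀ ⇒ p₂) (φ ∷ ψ ∷ χ ∷ []) · f

  ∨'-introˡ : ∀ φ ψ → L (φ ⇒ φ ∨' ψ)
  ∨'-introˡ φ ψ = taut₅ (p₀ ⇒ p₀ ∨' p₁) (φ ∷ ψ ∷ [])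

  ∨'-introʳ : ∀ φ ψ → L (ψ ⇒ φ ∨' ψ)
  ∨'-introʳ φ ψ = taut₅ (p₁ ⇒ p₀ ∨' p₁) (φ ∷ ψ ∷ [])

  ~~-elim : ∀ φ → L (~ (~ φ) ⇒ φ)
  ~~-elim φ = taut₅ (~ (~ p₀) ⇒ p₀) (φ ∷ [])

  K : ∀ φ ψ → L (□ (φ ⇒ ψ) ⇒ □ φ ⇒ □ ψ)
  K φ ψ = usubst (instantiate (φ ∷ ψ ∷ [])) _ axK

  □-mono : ∀ {φ ψ} → L (φ ⇒ ψ) → L (□ φ ⇒ □ ψ)
  □-mono {φ} {ψ} f = K φ ψ · nec _ f

  box^-mono : ∀ n {φ ψ} → L (φ ⇒ ψ) → L (box^ n φ ⇒ box^ n ψ)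
  box^-mono zero    f = f
  box^-mono (suc n) f = □-mono (box^-mono n f)

  ⋀-++ : ∀ φs ψs → L (⋀ (φs ++ ψs) ⇒ ⋀ φs ∧' ⋀ ψs)
  ⋀-++ []       ψs = taut₅ (p₀ ⇒ ⊤' ∧' p₀) (⋀ ψs ∷ [])
  ⋀-++ (φ ∷ φs) ψs = taut₅ ((p₀ ⇒ p₁ ∧' p₂) ⇒ p₃ ∧' p₀ ⇒ (p₃ ∧' p₁) ∧' p₂)
                            (⋀ (φs ++ ψs) ∷ ⋀ φs ∷ ⋀ ψs ∷ φ ∷ []) · ⋀-++ φs ψs

  ⋀-□ : ∀ {ψ} φs → L (⋀ φs ⇒ ψ) → L (⋀ (map □_ φs) ⇒ □ ψ)
  ⋀-□ {ψ} []       f = taut₅ (p₀ ⇒ ⊤' ⇒ p₀) (□ ψ ∷ []) · nec _ (taut₅ ((⊤' ⇒ p₀) ⇒ p₀) (ψ ∷ []) · f)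
  ⋀-□ {ψ} (φ ∷ φs) f = taut₅ ((p₀ ⇒ p₁) ⇒ (p₁ ⇒ p₂ ⇒ p₃) ⇒ p₂ ∧' p₀ ⇒ p₃)
                              (⋀ (map □_ φs) ∷ □ (φ ⇒ ψ) ∷ □ φ ∷ □ ψ ∷ [])
                       · ⋀-□ φs (∧'-curry-swap f) · K φ ψ

  infix 4 _⊢_
  -- Consistent L Γ is, by definition, ¬ (Γ ⊢ ⊥').
  _⊢_ : FmSet → Fm → Set
  Γ ⊢ φ = Σ (List Fm) λ φs → All Γ φs × L (⋀ φs ⇒ φ)

  ⊢-theorem : ∀ {Γ φ} → L φ → Γ ⊢ φ
  ⊢-theorem {φ = φ} f = [] , [] , taut₅ (p₀ ⇒ ⊤' ⇒ p₀) (φ ∷ []) · f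

  ⊢-assumption : ∀ {Γ φ} → Γ φ → Γ ⊢ φ
  ⊢-assumption {φ = φ} h = φ ∷ [] , h ∷ [] , taut₅ (p₀ ∧' ⊤' ⇒ p₀) (φ ∷ [])

  ⊢-mp : ∀ {Γ φ ψ} → Γ ⊢ φ → Γ ⊢ φ ⇒ ψ → Γ ⊢ ψ
  ⊢-mp {φ = φ} {ψ} (φs , hs , f) (ψs , ks , g) =
    φs ++ ψs , ++⁺ hs ks ,
    taut₅ ((p₀ ⇒ p₁ ∧' p₂) ⇒ (p₁ ⇒ p₃) ⇒ (p₂ ⇒ p₃ ⇒ p₄) ⇒ p₀ ⇒ p₄)
          (⋀ (φs ++ ψs) ∷ ⋀ φs ∷ ⋀ ψs ∷ φ ∷ ψ ∷ []) · ⋀-++ φs ψs · f · g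

  ⊢-by : ∀ {Γ φ ψ} → L (φ ⇒ ψ) → Γ ⊢ φ → Γ ⊢ ψ
  ⊢-by f d = ⊢-mp d (⊢-theorem f)

  ⊢-∧ : ∀ {Γ φ ψ} → Γ ⊢ φ → Γ ⊢ ψ → Γ ⊢ φ ∧' ψ
  ⊢-∧ {φ = φ} {ψ} d e = ⊢-mp e (⊢-by (taut₅ (p₀ ⇒ p₁ ⇒ p₀ ∧' p₁) (φ ∷ ψ ∷ [])) d)

  ⊢-⋀ : ∀ {Γ φs} → All (Γ ⊢_) φs → Γ ⊢ ⋀ φs
  ⊢-⋀ []       = ⊢-theorem (taut₅ ⊤' [])
  ⊢-⋀ (d ∷ ds) = ⊢-∧ d (⊢-⋀ ds)

  ⊢-deduction : ∀ {Γ φ ψ} → Γ ∪ ｛ φ ｝ ⊢ ψ → Γ ⊢ φ ⇒ ψ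
  ⊢-deduction {Γ} {φ} (χs , hs , f) = discharge χs hs f
    where
    discharge : ∀ {ψ} χs → All (Γ ∪ ｛ φ ｝) χs → L (⋀ χs ⇒ ψ) → Γ ⊢ φ ⇒ ψ
    discharge {ψ} []       []              f = ⊢-theorem (taut₅ ((⊤' ⇒ p₁) ⇒ p₀ ⇒ p₁) (φ ∷ ψ ∷ []) · f)
    discharge {ψ} (χ ∷ χs) (inj₁ χ∈Γ ∷ hs) f =
      ⊢-mp (⊢-assumption χ∈Γ)
           (⊢-by (taut₅ ((p₀ ⇒ p₁ ⇒ p₂) ⇒ p₁ ⇒ p₀ ⇒ p₂) (φ ∷ χ ∷ ψ ∷ [])) (discharge χs hs (∧'-curry-swap f)))
    discharge {ψ} (χ ∷ χs) (inj₂ refl ∷ hs) f =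
      ⊢-by (taut₅ ((p₀ ⇒ p₀ ⇒ p₁) ⇒ p₀ ⇒ p₁) (φ ∷ ψ ∷ [])) (discharge χs hs (∧'-curry-swap f))

  □⁻¹ : FmSet → FmSet
  □⁻¹ Γ φ = Γ (□ φ)

  ⊢-□ : ∀ {Γ ψ} → □⁻¹ Γ ⊢ ψ → Γ ⊢ □ ψ
  ⊢-□ (φs , hs , f) = map □_ φs , map⁺ hs , ⋀-□ φs f

  DownwardDirected : FmSet → Set
  DownwardDirected Θ = ∀ {θ₁ θ₂} → Θ θ₁ → Θ θ₂ → ∃ λ θ → Θ θ × L (θ ⇒ θ₁) × L (θ ⇒ θ₂)

  directed-lowerBound : ∀ {Γ Θ : FmSet} {θ₀} → Θ θ₀ → DownwardDirected Θ → ∀ {φs} → All (Γ ∪ Θ) φs →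
                        ∃ λ θ → Θ θ × All (λ φ → Γ φ ⊎ L (θ ⇒ φ)) φs
  directed-lowerBound θ₀∈Θ dir [] = _ , θ₀∈Θ , []
  directed-lowerBound θ₀∈Θ dir (inj₁ γ ∷ hs) with directed-lowerBound θ₀∈Θ dir hs
  ... | θ , θ∈Θ , ks = θ , θ∈Θ , inj₁ γ ∷ ks
  directed-lowerBound θ₀∈Θ dir (inj₂ φ∈Θ ∷ hs) with directed-lowerBound θ₀∈Θ dir hs
  ... | θ , θ∈Θ , ks with dir φ∈Θ θ∈Θ
  ... | θ′ , θ′∈Θ , θ′⇒φ , θ′⇒θ = θ′ , θ′∈Θ , inj₂ θ′⇒φ ∷ All.map (map₂ (⇒-trans θ′⇒θ)) ks

  consistent-∪-directed : ∀ {Γ Θ θ₀} → Θ θ₀ → DownwardDirected Θ →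
                          (∀ {θ} → Θ θ → Consistent L (Γ ∪ ｛ θ ｝)) → Consistent L (Γ ∪ Θ)
  consistent-∪-directed {Γ} θ₀∈Θ dir con (φs , hs , f) with directed-lowerBound θ₀∈Θ dir hs
  ... | θ , θ∈Θ , ks = con θ∈Θ (⊢-by f (⊢-⋀ (All.map derive ks)))
    where
    derive : ∀ {φ} → Γ φ ⊎ L (θ ⇒ φ) → Γ ∪ ｛ θ ｝ ⊢ φ
    derive (inj₁ γ)   = ⊢-assumption (inj₁ γ)
    derive (inj₂ θ⇒φ) = ⊢-by θ⇒φ (⊢-assumption (inj₂ refl))

module MaximalConsistent {L : FmSet} (NL : NormalLogic L) (a : Point L) where
  open Derivability NL

  consistent-∪⇒∈ : ∀ {φ} → Consistent L (set a ∪ ｛ φ ｝) → set a φ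
  consistent-∪⇒∈ {φ} con = proj₂ (maxcon a) (set a ∪ ｛ φ ｝) con (λ _ → inj₁) φ (inj₂ refl)

  ⊢⇒∈ : ∀ {φ} → set a ⊢ φ → set a φ
  ⊢⇒∈ d = consistent-∪⇒∈ λ e → proj₁ (maxcon a) (⊢-mp d (⊢-deduction e))

  ∈-by : ∀ {φ ψ} → L (φ ⇒ ψ) → set a φ → set a ψ
  ∈-by f = ⊢⇒∈ ∘ ⊢-by f ∘ ⊢-assumption

  ∈-mp : ∀ {φ ψ} → set a φ → set a (φ ⇒ ψ) → set a ψ
  ∈-mp h k = ⊢⇒∈ (⊢-mp (⊢-assumption h) (⊢-assumption k))

  ⊥'∉ : ¬ set a ⊥'
  ⊥'∉ = proj₁ (maxcon a) ∘ ⊢-assumption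

  ~∈⇒∉ : ∀ {φ} → set a (~ φ) → ¬ set a φ
  ~∈⇒∉ k h = ⊥'∉ (∈-mp h k)

  ∉⇒~∈ : ∀ {φ} → ¬ set a φ → set a (~ φ)
  ∉⇒~∈ {φ} φ∉ = consistent-∪⇒∈ λ e → φ∉ (⊢⇒∈ (⊢-by (~~-elim φ) (⊢-deduction e)))

  ∈-∨' : ExcludedMiddle 0ℓ → ∀ {φ ψ} → set a (φ ∨' ψ) → set a φ ⊎ set a ψ
  ∈-∨' em {φ} h with em {set a φ}
  ... | yes φ∈ = inj₁ φ∈
  ... | no  φ∉ = inj₂ (∈-mp (∉⇒~∈ φ∉) h)

module Classical (em : ExcludedMiddle 0ℓ) {L : FmSet} (NL : NormalLogic L) where
  open NormalLogic NL
  open Derivability NL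

  dne : {P : Set} → ¬ ¬ P → P
  dne = em⇒dne em

  canonical-successor : ∀ n (a b : Point L) → Transfer (suc n) b a → ∃ λ c → CanR L b c × Transfer n c a
  canonical-successor n a b transfer = c , (λ φ → Δ⊆c φ ∘ inj₁) , c-transfer
    where
    module A = MaximalConsistent NL a
    module B = MaximalConsistent NL b

    Refuted : FmSet
    Refuted ψ = ∃ λ χ → ¬ set a χ × ψ ≡ ~ box^ n χ

    refuted-directed : DownwardDirected Refuted
    refuted-directed (χ₁ , χ₁∉a , refl) (χ₂ , χ₂∉a , refl) =
      ~ box^ n (χ₁ ∨' χ₂) , (χ₁ ∨' χ₂ , [ χ₁∉a , χ₂∉a ]′ ∘ A.∈-∨' em , refl) ,
      ⇒-contra (box^-mono n (∨'-introˡ χ₁ χ₂)) , ⇒-contra (box^-mono n (∨'-introʳ χ₁ χ₂))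

    refuted-consistent : ∀ {θ} → Refuted θ → Consistent L (□⁻¹ (set b) ∪ ｛ θ ｝)
    refuted-consistent (χ , χ∉a , refl) d =
      χ∉a (transfer χ (B.⊢⇒∈ (⊢-□ (⊢-by (~~-elim (box^ n χ)) (⊢-deduction d)))))

    Δ : FmSet
    Δ = □⁻¹ (set b) ∪ Refuted

    Δ-consistent : Consistent L Δ
    Δ-consistent = consistent-∪-directed (⊥' , A.⊥'∉ , refl) refuted-directed refuted-consistent

    c : Point L
    c = proj₁ (lindenbaum Δ-consistent)

    Δ⊆c : Δ ⊆ set c
    Δ⊆c = proj₂ (lindenbaum Δ-consistent)

    c-transfer : Transfer n c a
    c-transfer φ h = dne λ φ∉a → MaximalConsistent.~∈⇒∉ NL c (Δ⊆c _ (inj₂ (φ , φ∉a , refl))) h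

  transfer⇒R⁺ : ∀ n {a b : Point L} → Transfer (suc n) b a → CanR* L b a
  transfer⇒R⁺ zero    transfer = transfer ◅ ε
  transfer⇒R⁺ (suc n) {a} {b} transfer with canonical-successor (suc n) a b transfer
  ... | c , bRc , c-transfer = _◅_ {j = c} bRc (transfer⇒R⁺ n c-transfer)

  ~box^⇒◇^~ : ∀ n χ → L (~ box^ n χ ⇒ ◇^ n (~ χ))
  ~box^⇒◇^~ zero    χ = taut₅ (~ p₀ ⇒ ~ p₀) (χ ∷ [])
  ~box^⇒◇^~ (suc n) χ = ⇒-contra (□-mono (taut₅ ((~ p₀ ⇒ p₁) ⇒ ~ p₁ ⇒ p₀) (box^ n χ ∷ ◇^ n (~ χ) ∷ [])
                                            · ~box^⇒◇^~ n χ))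

  ◇^~⇒~box^ : ∀ n χ → L (◇^ n (~ χ) ⇒ ~ box^ n χ)
  ◇^~⇒~box^ zero    χ = taut₅ (~ p₀ ⇒ ~ p₀) (χ ∷ [])
  ◇^~⇒~box^ (suc n) χ = ⇒-contra (□-mono (taut₅ ((p₀ ⇒ ~ p₁) ⇒ p₁ ⇒ ~ p₀) (◇^ n (~ χ) ∷ box^ n χ ∷ [])
                                            · ◇^~⇒~box^ n χ))

  module Pretransitivity {m} (m-transitive : Transitive[ m ] L) where

    transitivity : ∀ φ → L (◇^ (suc m) φ ⇒ bigDisj◇ m φ)
    transitivity φ = ≡.subst L (cong₂ _⇒_ (◇^-subst σ (suc m)) (bigDisj◇-subst σ m)) (usubst σ _ m-transitive)
      where
      σ : ℕ → Fm
      σ = instantiate (φ ∷ [])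

    module _ (b : Point L) where
      open MaximalConsistent NL b

      BoxedUpTo : ℕ → Fm → Set
      BoxedUpTo j ψ = ∀ i → i ≤ j → set b (box^ i ψ)

      ∈-bigDisj◇ : ∀ k φ → set b (bigDisj◇ k φ) → ∃ λ i → i ≤ k × set b (◇^ i φ)
      ∈-bigDisj◇ zero    φ h = 0 , z≤n , h
      ∈-bigDisj◇ (suc k) φ h with ∈-∨' em h
      ... | inj₂ h′ = suc k , ≤-refl , h′
      ... | inj₁ h′ with ∈-bigDisj◇ k φ h′
      ...   | i , i≤k , h″ = i , m≤n⇒m≤1+n i≤k , h″

      box^-step : ∀ χ → BoxedUpTo m χ → set b (box^ (suc m) χ)
      box^-step χ boxed = dne λ ∉ → refute (∈-bigDisj◇ m (~ χ)
        (∈-by (transitivity (~ χ)) (∈-by (~box^⇒◇^~ (suc m) χ) (∉⇒~∈ ∉))))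
        where
        refute : ¬ ∃ λ i → i ≤ m × set b (◇^ i (~ χ))
        refute (i , i≤m , h) = ~∈⇒∉ (∈-by (◇^~⇒~box^ i χ) h) (boxed i i≤m)

      boxedUpTo-□ : ∀ {χ} → BoxedUpTo m χ → BoxedUpTo m (□ χ)
      boxedUpTo-□ {χ} boxed i i≤m rewrite box^-□ i χ with m≤n⇒m<n∨m≡n i≤m
      ... | inj₁ i<m  = boxed (suc i) i<m
      ... | inj₂ refl = box^-step χ boxed

      boxedUpTo⇒boxes : ∀ {ψ} → BoxedUpTo m ψ → boxes ψ ⊆ set b
      boxedUpTo⇒boxes {ψ} boxed _ (k , refl) = iterate k 0 z≤n
        where
        iterate : ∀ k → BoxedUpTo m (box^ k ψ)
        iterate zero    = boxed
        iterate (suc k) = boxedUpTo-□ (iterate k)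

      counterexample : ∀ (a : Point L) i → ¬ Transfer i b a →
                       ∃ λ φ → set b (box^ i φ) × ¬ set a φ
      counterexample a i ¬transfer = dne λ none → ¬transfer λ φ h → dne λ φ∉a → none (φ , h , φ∉a)

      joint-counterexample : ∀ (a : Point L) j → (∀ i → ∃ λ φ → set b (box^ i φ) × ¬ set a φ) →
                             ∃ λ ψ → BoxedUpTo j ψ × ¬ set a ψ
      joint-counterexample a zero counter with counter 0
      ... | φ , h , φ∉a = φ , (λ { .0 z≤n → h }) , φ∉a
      joint-counterexample a (suc j) counter with joint-counterexample a j counter | counter (suc j)
      ... | ψ , boxed , ψ∉a | φ , h , φ∉a = ψ ∨' φ , boxed′ , [ ψ∉a , φ∉a ]′ ∘ MaximalConsistent.∈-∨' NL a em
        where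
        boxed′ : BoxedUpTo (suc j) (ψ ∨' φ)
        boxed′ i i≤1+j with m≤n⇒m<n∨m≡n i≤1+j
        ... | inj₁ (s≤s i≤j) = ∈-by (box^-mono i (∨'-introˡ ψ φ)) (boxed i i≤j)
        ... | inj₂ refl      = ∈-by (box^-mono (suc j) (∨'-introʳ ψ φ)) h

      transfer-bounded : ∀ (a : Point L) → Transfer* b a → ∃ λ i → Transfer i b a
      transfer-bounded a transfer = dne λ none →
        let (ψ , boxed , ψ∉a) = joint-counterexample a m (λ i → counterexample a i (λ t → none (i , t)))
        in  ψ∉a (transfer ψ (boxedUpTo⇒boxes boxed))

    R*-reverse : ∀ {a b : Point L} → Transfer* b a → CanR* L a b → CanR* L b a
    R*-reverse {a} {b} transfer a↝b with transfer-bounded b a transfer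
    ... | zero  , b⊆a       = R*-reverse-⊆ b⊆a a↝b
    ... | suc n , transfer′ = transfer⇒R⁺ n transfer′

proposition31 : ExcludedMiddle 0ℓ →
    (L : FmSet) → NormalLogic L → Pretransitive L →
    (Ψ : FmSet) →
    (∃ λ (a : Point L) → Ψ ⊆ set a) →
    Σ (Point L) λ a → (Ψ ⊆ set a) ×
      (∀ (b : Point L) → Ψ ⊆ set b → CanR* L a b → CanR* L b a)
proposition31 em L NL (m , m-transitive) Ψ (a₀ , Ψ⊆a₀) = a , (λ φ → limit⊆a φ ∘ Γ₀⊆limit φ) , maximal
  where
  open Saturation L boxes Ψ

  limit-con : Consistent L limit
  limit-con = limit-consistent (Consistent-⊆ {L} Ψ⊆a₀ (proj₁ (maxcon a₀)))

  a : Point L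
  a = proj₁ (lindenbaum limit-con)

  limit⊆a : limit ⊆ set a
  limit⊆a = proj₂ (lindenbaum limit-con)

  maximal : ∀ b → Ψ ⊆ set b → CanR* L a b → CanR* L b a
  maximal b Ψ⊆b a↝b = Classical.Pretransitivity.R*-reverse em NL m-transitive transfer a↝b
    where
    limit⊆b : limit ⊆ set b
    limit⊆b χ h with limit-generated χ h
    ... | inj₁ χ∈Ψ                   = Ψ⊆b χ χ∈Ψ
    ... | inj₂ (φ , χ∈□φ , □φ⊆limit) = boxes-R* a↝b φ (λ ψ → limit⊆a ψ ∘ □φ⊆limit ψ) χ χ∈□φ

    transfer : Transfer* b a
    transfer φ □φ⊆b = limit⊆a φ (limit-saturated (proj₁ (maxcon b)) limit⊆b φ □φ⊆b φ (0 , refl))
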